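{- Let $R$ be a right fountain triangulation of $\mathbb{N}$ with fountain point $0$, let $m$ be a positive integer, and let $\mu(R)$ be the mutation of $R$ at the arc $(\boldsymbol{y}^R_m,\boldsymbol{y}^R_{m+1})$. Then the sequences $\boldsymbol{x}^R$ and $\boldsymbol{x}^{\mu(R)}$ differ in exactly one place.
   Context: Arcs are pairs $(a,b)$ of integers with $0\le a<b$; arcs $(a,b),(c,d)$ cross if $a<c<b<d$ or $c<a<d<b$. A triangulation of $\mathbb{N}$ is a maximal set of pairwise noncrossing arcs. A right fountain triangulation with fountain point $0$ is such a triangulation $R$ containing $(0,n)$ for infinitely many $n$. $\boldsymbol{x}^R_n=1$ if $(0,n+1)\in R$ and $0$ otherwise ($n\ge1$); $\boldsymbol{y}^R_n$ is the $(n+1)$-st positive integer $\ell$ with $(0,\ell)\in R$. The arc $(\boldsymbol{y}^R_m,\boldsymbol{y}^R_{m+1})$ lies in $R$. Mutation at an arc $\gamma\in R$ (defined when $\gamma$ is not a boundary arc $(a,a+1)$): $\gamma$ is the diagonal of a unique quadrilateral formed by two triangles of $R$, and $\mu(R)$ replaces $\gamma$ with the other diagonal. -}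

module Defs where

open import Data.Nat using (ℕ; zero; suc; _+_; _∸_; _<_; _≤_; _⊓_; _⊔_)
open import Data.Bool using (Bool; true; false; if_then_else_)
open import Data.Product using (Σ; ∃; _×_; _,_)
open import Data.Sum using (_⊎_)
open import Relation.Nullary using (¬_)
open import Relation.Binary.PropositionalEquality using (_≡_; _≢_)
open import Function.Bundles using (_⇔_)

ArcSet : Set
ArcSet = ℕ → ℕ → Bool

_∋_,_ : ArcSet → ℕ → ℕ → Set
R ∋ a , b = R a b ≡ true

Crosses : ℕ → ℕ → ℕ → ℕ → Set
Crosses a b c d = (a < c × c < b × b < d) ⊎ (c < a × a < d × d < b)

record IsTriangulation (R : ArcSet) : Set where
  field
    onlyArcs    : ∀ a b → R ∋ a , b → a < b
    noncrossing : ∀ a b c d → R ∋ a , b → R ∋ c , d → ¬ Crosses a b c d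
    maximal     : ∀ a b → a < b → (∀ c d → R ∋ c , d → ¬ Crosses a b c d) → R ∋ a , b

record IsRightFountain0 (R : ArcSet) : Set where
  field
    triangulation : IsTriangulation R
    fountain      : ∀ N → ∃ λ n → N < n × R ∋ 0 , n

-- x^R_n (meaningful for n ≥ 1): true iff (0, n+1) ∈ R
xSeq : ArcSet → ℕ → Bool
xSeq R n = R 0 (suc n)

count : (ℕ → Bool) → ℕ → ℕ
count f zero    = 0
count f (suc k) = count f k + (if f k then 1 else 0)

-- IsY R n ℓ : ℓ is the (n+1)-st positive integer with (0, ℓ) ∈ R, i.e. y^R_n = ℓ
IsY : ArcSet → ℕ → ℕ → Set
IsY R n ℓ = 0 < ℓ × R ∋ 0 , ℓ × count (λ i → R 0 (suc i)) (ℓ ∸ 1) ≡ n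

TriangleOn : ArcSet → ℕ → ℕ → ℕ → Set
TriangleOn R p q v =
    (v < p × R ∋ v , p × R ∋ v , q)
  ⊎ (p < v × v < q × R ∋ p , v × R ∋ v , q)
  ⊎ (q < v × R ∋ p , v × R ∋ q , v)

-- R' is the mutation of R at the arc (p , q) ∈ R: (p , q) is not a boundary arc,
-- it is the diagonal of the quadrilateral formed by two (distinct) triangles of R
-- with third vertices r ≠ s, and R' replaces (p , q) by the other diagonal (r , s).
IsMutation : ArcSet → ℕ → ℕ → ArcSet → Set
IsMutation R p q R' =
  R ∋ p , q × suc p < q ×
  Σ ℕ λ r → Σ ℕ λ s → r ≢ s × TriangleOn R p q r × TriangleOn R p q s ×
    (∀ a b → (R' ∋ a , b) ⇔ ((R ∋ a , b × ¬ (a ≡ p × b ≡ q)) ⊎ (a ≡ r ⊓ s × b ≡ r ⊔ s)))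

DifferInExactlyOnePlace : ArcSet → ArcSet → Set
DifferInExactlyOnePlace R R' =
  ∃ λ n → 1 ≤ n × xSeq R n ≢ xSeq R' n ×
    (∀ k → 1 ≤ k → k ≢ n → xSeq R k ≡ xSeq R' k)

{-# OPTIONS --safe #-}
module Submission where

open import Defs
open import Data.Nat using (ℕ; zero; suc; _≤_; _<_; _⊓_; _⊔_; s≤s)
open import Data.Nat.Properties
open import Data.Bool using (Bool; true; false)
open import Data.Bool.Properties using (⇔→≡)
open import Data.Product using (∃; _×_; _,_)
open import Data.Sum using (_⊎_; inj₁; inj₂)
open import Data.Empty using (⊥-elim)
open import Relation.Nullary using (¬_)
open import Relation.Binary using (tri<; tri≈; tri>)
open import Relation.Binary.PropositionalEquality
open import Function.Bundles using (_⇔_; mk⇔; Equivalence)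
open import Function.Base using (_∘_)

-- The arc (y_m, y_{m+1}) and the fountain arcs (0, y_m), (0, y_{m+1}) bound a
-- triangle of R, so one apex of the quadrilateral around (y_m, y_{m+1}) is 0;
-- noncrossing forces the other apex c to lie strictly between y_m and y_{m+1}.
-- The mutation thus adds (0, c) and removes only (y_m, y_{m+1}), which is not
-- a fountain arc. As y_m and y_{m+1} are consecutive fountain endpoints,
-- (0, c) ∉ R, so x changes exactly at position c - 1.

count-mono : ∀ f {j k} → j ≤ k → count f j ≤ count f k
count-mono f {k = zero} j≤0 = ≤-reflexive (cong (count f) (n≤0⇒n≡0 j≤0))
count-mono f {k = suc k} j≤1+k with m≤n⇒m<n∨m≡n j≤1+k
... | inj₁ (s≤s j≤k) = ≤-trans (count-mono f j≤k) (m≤m+n _ _)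
... | inj₂ refl      = ≤-refl

count-suc-true : ∀ f {i} → f i ≡ true → count f (suc i) ≡ suc (count f i)
count-suc-true f {i} fi≡true rewrite fi≡true = +-comm (count f i) 1

count-≡⇒false : ∀ f {j k i} → j ≤ i → i < k → count f j ≡ count f k → f i ≡ false
count-≡⇒false f {j} {k} {i} j≤i i<k eq with f i in fi
... | false = refl
... | true  = ⊥-elim (<-irrefl eq (begin-strict
  count f j        ≤⟨ count-mono f j≤i ⟩
  count f i        <⟨ n<1+n _ ⟩
  suc (count f i)  ≡⟨ count-suc-true f fi ⟨
  count f (suc i)  ≤⟨ count-mono f i<k ⟩
  count f k        ∎))
  where open ≤-Reasoning

fountain-gap : ∀ R {m a b ℓ} → IsY R m a → IsY R (suc m) b → a < ℓ → ℓ < b → R 0 ℓ ≡ false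
fountain-gap R {m} {suc a} {suc b} {suc ℓ} (_ , R∋0,a , count≡m) (_ , _ , count≡1+m) (s≤s a<ℓ) (s≤s ℓ<b) =
  count-≡⇒false xs a<ℓ ℓ<b (begin
    count xs (suc a)  ≡⟨ count-suc-true xs R∋0,a ⟩
    suc (count xs a)  ≡⟨ cong suc count≡m ⟩
    suc m             ≡⟨ count≡1+m ⟨
    count xs b        ∎)
  where
  open ≡-Reasoning
  xs : ℕ → Bool
  xs i = R 0 (suc i)

ArcReplacement : ArcSet → ℕ → ℕ → ℕ → ℕ → ArcSet → Set
ArcReplacement R p q u v R' =
  ∀ x y → (R' ∋ x , y) ⇔ ((R ∋ x , y × ¬ (x ≡ p × y ≡ q)) ⊎ (x ≡ u × y ≡ v))

replacement-keeps : ∀ {R p q u v R' x y} → ArcReplacement R p q u v R' →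
  ¬ (x ≡ p × y ≡ q) → ¬ (x ≡ u × y ≡ v) → R' x y ≡ R x y
replacement-keeps {R} {R' = R'} {x} {y} R'⇔ ≢pq ≢uv =
  ⇔→≡ (mk⇔ old (λ R∋ → Equivalence.from (R'⇔ x y) (inj₁ (R∋ , ≢pq))))
  where
  old : R' ∋ x , y → R ∋ x , y
  old R'∋ with Equivalence.to (R'⇔ x y) R'∋
  ... | inj₁ (R∋ , _) = R∋
  ... | inj₂ ≡uv      = ⊥-elim (≢uv ≡uv)

module _ {R : ArcSet} (T : IsTriangulation R) where
  open IsTriangulation T

  InnerApex : ℕ → ℕ → ℕ → Set
  InnerApex a b v = a < v × v < b × R ∋ a , v × R ∋ v , b

  inner-apex-unique : ∀ {a b r s} → InnerApex a b r → InnerApex a b s → r ≡ s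
  inner-apex-unique {a} {b} {r} {s} (a<r , r<b , R∋a,r , R∋r,b) (a<s , s<b , R∋a,s , R∋s,b) with <-cmp r s
  ... | tri< r<s _ _ = ⊥-elim (noncrossing a s r b R∋a,s R∋r,b (inj₁ (a<r , r<s , s<b)))
  ... | tri≈ _ r≡s _ = r≡s
  ... | tri> _ _ s<r = ⊥-elim (noncrossing a r s b R∋a,r R∋s,b (inj₁ (a<s , s<r , r<b)))

  module _ {a b} (0<a : 0 < a) (R∋0,a : R ∋ 0 , a) (R∋0,b : R ∋ 0 , b) (R∋a,b : R ∋ a , b) where

    fan-apex : ∀ {v} → TriangleOn R a b v → v ≡ 0 ⊎ InnerApex a b v
    fan-apex {zero}  (inj₁ _)                          = inj₁ refl
    fan-apex {suc v} (inj₁ (v<a , _ , R∋v,b))          =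
      ⊥-elim (noncrossing 0 a (suc v) b R∋0,a R∋v,b (inj₁ (0<1+n , v<a , onlyArcs a b R∋a,b)))
    fan-apex         (inj₂ (inj₁ inner))               = inj₂ inner
    fan-apex {v}     (inj₂ (inj₂ (b<v , R∋a,v , _)))   =
      ⊥-elim (noncrossing 0 b a v R∋0,b R∋a,v (inj₁ (0<a , onlyArcs a b R∋a,b , b<v)))

    fan-apexes : ∀ {r s} → r ≢ s → TriangleOn R a b r → TriangleOn R a b s →
                 ∃ λ c → InnerApex a b c × r ⊓ s ≡ 0 × r ⊔ s ≡ c
    fan-apexes {r} {s} r≢s tr ts with fan-apex tr | fan-apex ts
    ... | inj₁ refl | inj₁ refl = ⊥-elim (r≢s refl)
    ... | inj₁ refl | inj₂ is   = s , is , refl , refl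
    ... | inj₂ ir   | inj₁ refl = r , ir , ⊓-zeroʳ r , ⊔-identityʳ r
    ... | inj₂ ir   | inj₂ is   = ⊥-elim (r≢s (inner-apex-unique ir is))

    mutation-adds-fan-arc : ∀ {R'} → IsMutation R a b R' →
      ∃ λ c → a < c × c < b × R' ∋ 0 , c × (∀ ℓ → ℓ ≢ c → R' 0 ℓ ≡ R 0 ℓ)
    mutation-adds-fan-arc {R'} (_ , _ , r , s , r≢s , tr , ts , R'⇔) with fan-apexes r≢s tr ts
    ... | c , (a<c , c<b , _) , r⊓s≡0 , r⊔s≡c =
      c , a<c , c<b , Equivalence.from (R'⇔ 0 c) (inj₂ (sym r⊓s≡0 , sym r⊔s≡c)) , unchanged
      where
      unchanged : ∀ ℓ → ℓ ≢ c → R' 0 ℓ ≡ R 0 ℓ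
      unchanged ℓ ℓ≢c = replacement-keeps R'⇔ (λ (0≡a , _) → <⇒≢ 0<a 0≡a)
                                               (λ (_ , ℓ≡r⊔s) → ℓ≢c (trans ℓ≡r⊔s r⊔s≡c))

lemma3p11 : (R : ArcSet) → IsRightFountain0 R → (m : ℕ) → 1 ≤ m →
    (a b : ℕ) → IsY R m a → IsY R (suc m) b →
    (R' : ArcSet) → IsMutation R a b R' → DifferInExactlyOnePlace R R'
lemma3p11 R F _ _ a b ya@(0<a , R∋0,a , _) yb@(_ , R∋0,b , _) R' μ@(R∋a,b , _)
  with mutation-adds-fan-arc (IsRightFountain0.triangulation F) 0<a R∋0,a R∋0,b R∋a,b μ
... | zero  , () , _
... | suc n , a<c , c<b , R'∋0,c , unchanged = n , 1≤n , flipped , agree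
  where
  1≤n : 1 ≤ n
  1≤n = ≤-trans 0<a (≤-pred a<c)
  flipped : xSeq R n ≢ xSeq R' n
  flipped eq with () ← trans (sym (fountain-gap R ya yb a<c c<b)) (trans eq R'∋0,c)
  agree : ∀ k → 1 ≤ k → k ≢ n → xSeq R k ≡ xSeq R' k
  agree k _ k≢n = sym (unchanged (suc k) (k≢n ∘ suc-injective))
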